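{- If $n=2k+1$ with $k\ge0$, then $|S_n|=42\cdot4^k-34\cdot2^k+8$. If $n=2k$ with $k\ge1$, then $|S_n|=21\cdot4^k-24\cdot2^k+8$.
   Context: For $k\ge0$, $w_{2k}=3\cdot2^k$, $w_{2k+1}=4\cdot2^k$. $S_n=\{x+yi\in\mathbb{Z}[i]\setminus\{0\}: |x|,|y|\le w_n-2,\ |x|+|y|\le w_{n+1}-3,\ 2\nmid\gcd(x,y)\}$. -}

module Defs where

open import Data.Nat as ℕ using (ℕ; _∸_; _^_; _%_; _/_)
open import Data.Nat.Divisibility as ℕD using (_∣?_)
open import Data.Nat.GCD as ℕG using ()
open import Data.Integer as ℤ using (ℤ; +_; ∣_∣; _-_; _≤_; _≤?_)
open import Data.Integer.Divisibility using (_∣_)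
open import Data.Integer.GCD using (gcd)
open import Data.Product using (_×_; _,_)
open import Data.Product.Properties using (≡-dec)
open import Data.List using (List; upTo; map; concatMap; filter; length)
open import Relation.Nullary using (¬_; Dec; yes; no)
open import Relation.Nullary.Decidable using (_×-dec_; ¬?)
open import Relation.Binary.PropositionalEquality using (_≡_)

-- w_n : for n = 2k it is 3·2^k, for n = 2k+1 it is 4·2^k
-- (n % 2 is the parity bit, n / 2 = k).
w : ℕ → ℕ
w n = (3 ℕ.+ n % 2) ℕ.* 2 ^ (n / 2)

GaussInt : Set
GaussInt = ℤ × ℤ

InS : ℕ → GaussInt → Set
InS n (x , y) =
  ¬ ((x , y) ≡ (+ 0 , + 0)) ×
  (+ ∣ x ∣ ≤ + (w n ∸ 2)) ×
  (+ ∣ y ∣ ≤ + (w n ∸ 2)) ×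
  (+ (∣ x ∣ ℕ.+ ∣ y ∣) ≤ + (w (ℕ.suc n) ∸ 3)) ×
  ¬ (+ 2 ∣ gcd x y)

-- 2 ∣ gcd x y on ℤ is by definition 2 ∣ ℕG.gcd ∣x∣ ∣y∣ on ℕ.
InS? : (n : ℕ) (z : GaussInt) → Dec (InS n z)
InS? n (x , y) =
  ¬? (≡-dec ℤ._≟_ ℤ._≟_ (x , y) (+ 0 , + 0)) ×-dec
  (+ ∣ x ∣ ≤? + (w n ∸ 2)) ×-dec
  (+ ∣ y ∣ ≤? + (w n ∸ 2)) ×-dec
  (+ (∣ x ∣ ℕ.+ ∣ y ∣) ≤? + (w (ℕ.suc n) ∸ 3)) ×-dec
  ¬? (2 ∣? ℕG.gcd ∣ x ∣ ∣ y ∣)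

range : ℕ → List ℤ
range B = map (λ i → + i - + B) (upTo (ℕ.suc (2 ℕ.* B)))

box : ℕ → List GaussInt
box B = concatMap (λ x → map (λ y → (x , y)) (range B)) (range B)

-- S_n as an explicit duplicate-free list: S_n ⊆ box (w n ∸ 2).
S : ℕ → List GaussInt
S n = filter (InS? n) (box (w n ∸ 2))

cardS : ℕ → ℕ
cardS n = length (S n)

-- Everything is counted through the absolute values a = ∣ x ∣, b = ∣ y ∣: S_n is the set of points of the region
-- a, b ≤ B = w_n - 2, a + b ≤ D = w_(n+1) - 3 whose coordinates are not both even (gcd x y is odd).
-- Writing B = e + t and D = B + e, the region has (1 + 2 e) (1 + 2 B) + 2 t (t + 2 e) points: the rows with a ≤ e
-- are full and the remaining rows have odd lengths decreasing by 2. B is even and D odd, so the even points of the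
-- region are the doubles of the points of the region for (B / 2, (D - 1) / 2), which has the same shape. Since w_n
-- and w_(n+1) are 3 and 4 times a power of 2, |S_n| is the difference of two such counts, a polynomial in 2^k.

module Submission where

open import Data.Bool.Base using (true; false)
open import Data.Integer as ℤ using (ℤ; +_; ∣_∣)
import Data.Integer.Properties as ℤP
open import Data.Integer.Tactic.RingSolver using () renaming (solve-∀ to ℤ-solve-∀)
open import Data.List using (List; []; _∷_; _++_; map; concatMap; filter; length; applyUpTo; upTo)
open import Data.List.Properties using (map-++; map-∘; map-cong)
open import Data.Nat
open import Data.Nat.DivMod
open import Data.Nat.Divisibility using (_∣_; _∣?_; divides; m∣m*n; ∣-trans)
import Data.Nat.GCD as ℕG
open import Data.Nat.ListAction using (sum)
open import Data.Nat.ListAction.Properties using (sum-++)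
open import Data.Nat.Properties
open import Algebra.Properties.CommutativeSemigroup +-commutativeSemigroup using (interchange; xy∙z≈xz∙y)
open import Data.Nat.Tactic.RingSolver using (solve-∀)
open import Data.Product using (_×_; _,_; proj₁; proj₂)
open import Function using (_∘_)
open import Relation.Nullary using (Dec; yes; no; _because_; ¬_; contradiction)
open import Relation.Nullary.Decidable using (_×-dec_; ¬?)
open import Relation.Binary.PropositionalEquality
open import Defs

𝟙 : {P : Set} → Dec P → ℕ
𝟙 (true  because _) = 1
𝟙 (false because _) = 0

𝟙-yes : {P : Set} (p? : Dec P) → P → 𝟙 p? ≡ 1
𝟙-yes (yes _) _ = refl
𝟙-yes (no ¬p) p = contradiction p ¬p

𝟙-no : {P : Set} (p? : Dec P) → ¬ P → 𝟙 p? ≡ 0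
𝟙-no (yes p) ¬p = contradiction p ¬p
𝟙-no (no _)  _  = refl

𝟙-cong : {P Q : Set} (p? : Dec P) (q? : Dec Q) → (P → Q) → (Q → P) → 𝟙 p? ≡ 𝟙 q?
𝟙-cong (yes p) q? f g = sym (𝟙-yes q? (f p))
𝟙-cong (no ¬p) q? f g = sym (𝟙-no q? (¬p ∘ g))

𝟙-split : {P Q : Set} (p? : Dec P) (q? : Dec Q) → 𝟙 (p? ×-dec ¬? q?) + 𝟙 (p? ×-dec q?) ≡ 𝟙 p?
𝟙-split (yes _) (yes _) = refl
𝟙-split (yes _) (no _)  = refl
𝟙-split (no _)  _       = refl

module _ {A : Set} where

  length-filter≡sum-𝟙 : {P : A → Set} (P? : ∀ x → Dec (P x)) (xs : List A) →
                        length (filter P? xs) ≡ sum (map (𝟙 ∘ P?) xs)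
  length-filter≡sum-𝟙 P? []       = refl
  length-filter≡sum-𝟙 P? (x ∷ xs) with P? x
  ... | yes _ = cong suc (length-filter≡sum-𝟙 P? xs)
  ... | no  _ = length-filter≡sum-𝟙 P? xs

  sum-concatMap : {B : Set} (f : A → List B) (g : B → ℕ) (xs : List A) →
                  sum (map g (concatMap f xs)) ≡ sum (map (λ x → sum (map g (f x))) xs)
  sum-concatMap f g []       = refl
  sum-concatMap f g (x ∷ xs) = begin
    sum (map g (f x ++ concatMap f xs))              ≡⟨ cong sum (map-++ g (f x) _) ⟩
    sum (map g (f x) ++ map g (concatMap f xs))      ≡⟨ sum-++ (map g (f x)) _ ⟩
    sum (map g (f x)) + sum (map g (concatMap f xs)) ≡⟨ cong (_+_ (sum (map g (f x)))) (sum-concatMap f g xs) ⟩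
    sum (map g (f x)) + sum (map (λ y → sum (map g (f y))) xs) ∎
    where open ≡-Reasoning

∑ : ℕ → (ℕ → ℕ) → ℕ
∑ zero    f = 0
∑ (suc n) f = f 0 + ∑ n (f ∘ suc)

sum-applyUpTo : (h f : ℕ → ℕ) (n : ℕ) → sum (map h (applyUpTo f n)) ≡ ∑ n (h ∘ f)
sum-applyUpTo h f zero    = refl
sum-applyUpTo h f (suc n) = cong (_+_ (h (f 0))) (sum-applyUpTo h (f ∘ suc) n)

∑-cong : ∀ n {f g : ℕ → ℕ} → (∀ i → i < n → f i ≡ g i) → ∑ n f ≡ ∑ n g
∑-cong zero    eq = refl
∑-cong (suc n) eq = cong₂ _+_ (eq 0 z<s) (∑-cong n (λ i i<n → eq (suc i) (s<s i<n)))

∑-const : ∀ n c → ∑ n (λ _ → c) ≡ n * c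
∑-const zero    c = refl
∑-const (suc n) c = cong (_+_ c) (∑-const n c)

∑-+ : ∀ n (f g : ℕ → ℕ) → ∑ n (λ i → f i + g i) ≡ ∑ n f + ∑ n g
∑-+ zero    f g = refl
∑-+ (suc n) f g = trans (cong (_+_ (f 0 + g 0)) (∑-+ n (f ∘ suc) (g ∘ suc))) (interchange (f 0) (g 0) _ _)

∑-split : ∀ m n (f : ℕ → ℕ) → ∑ (m + n) f ≡ ∑ m f + ∑ n (λ i → f (m + i))
∑-split zero    n f = refl
∑-split (suc m) n f = trans (cong (_+_ (f 0)) (∑-split m n (f ∘ suc))) (sym (+-assoc (f 0) _ _))

∑-snoc : ∀ n (f : ℕ → ℕ) → ∑ (suc n) f ≡ ∑ n f + f n
∑-snoc zero    f = +-identityʳ (f 0)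
∑-snoc (suc n) f = trans (cong (_+_ (f 0)) (∑-snoc n (f ∘ suc))) (sym (+-assoc (f 0) _ _))

∑-reverse : ∀ n (f : ℕ → ℕ) → ∑ n f ≡ ∑ n (λ i → f (n ∸ suc i))
∑-reverse zero    f = refl
∑-reverse (suc n) f = begin
  ∑ (suc n) f                   ≡⟨ ∑-snoc n f ⟩
  ∑ n f + f n                   ≡⟨ +-comm (∑ n f) (f n) ⟩
  f n + ∑ n f                   ≡⟨ cong (_+_ (f n)) (∑-reverse n f) ⟩
  f n + ∑ n (λ i → f (n ∸ suc i)) ∎
  where open ≡-Reasoning

∑-pairs : ∀ n (f : ℕ → ℕ) → ∑ (2 * n) f ≡ ∑ n (λ j → f (2 * j) + f (1 + 2 * j))
∑-pairs zero    f = refl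
∑-pairs (suc n) f = begin
  ∑ (2 * suc n) f                                         ≡⟨ cong (λ m → ∑ m f) (2[1+n] n) ⟩
  f 0 + (f 1 + ∑ (2 * n) (f ∘ (_+_ 2)))                   ≡⟨ sym (+-assoc (f 0) (f 1) _) ⟩
  f 0 + f 1 + ∑ (2 * n) (f ∘ (_+_ 2))                     ≡⟨ cong (_+_ (f 0 + f 1)) (∑-pairs n (f ∘ (_+_ 2))) ⟩
  f 0 + f 1 + ∑ n (λ j → f (2 + 2 * j) + f (3 + 2 * j))   ≡⟨ cong (_+_ (f 0 + f 1)) (∑-cong n shift) ⟩
  ∑ (suc n) (λ j → f (2 * j) + f (1 + 2 * j))             ∎
  where
  open ≡-Reasoning
  2[1+n] : ∀ n → 2 * suc n ≡ 2 + 2 * n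
  2[1+n] = solve-∀
  shift : ∀ j → j < n → f (2 + 2 * j) + f (3 + 2 * j) ≡ f (2 * suc j) + f (1 + 2 * suc j)
  shift j _ = cong₂ (λ u v → f u + f v) (sym (2[1+n] j)) (cong suc (sym (2[1+n] j)))

∑-prefix : ∀ n c (f : ℕ → ℕ) → c ≤ n → (∀ i → i < c → f i ≡ 1) → (∀ i → c ≤ i → i < n → f i ≡ 0) →
           ∑ n f ≡ c
∑-prefix zero    .zero   f z≤n       _    _     = refl
∑-prefix (suc n) zero    f z≤n       _    zeros =
  cong₂ _+_ (zeros 0 z≤n z<s) (∑-prefix n 0 (f ∘ suc) z≤n (λ _ ()) (λ i _ i<n → zeros (suc i) z≤n (s<s i<n)))
∑-prefix (suc n) (suc c) f (s≤s c≤n) ones zeros =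
  cong₂ _+_ (ones 0 z<s)
    (∑-prefix n c (f ∘ suc) c≤n (λ i i<c → ones (suc i) (s<s i<c)) (λ i c≤i i<n → zeros (suc i) (s≤s c≤i) (s<s i<n)))

∑-descending-odd : ∀ t e → ∑ t (λ i → 1 + 2 * (e + (t ∸ suc i))) ≡ t * (t + 2 * e)
∑-descending-odd zero    e = refl
∑-descending-odd (suc t) e = trans (cong (_+_ (1 + 2 * (e + t))) (∑-descending-odd t e)) (step t e)
  where
  step : ∀ t e → 1 + 2 * (e + t) + t * (t + 2 * e) ≡ suc t * (suc t + 2 * e)
  step = solve-∀

-- Σ± B g is the sum of g ∣ x ∣ over the integers -B ≤ x ≤ B.
Σ± : ℕ → (ℕ → ℕ) → ℕ
Σ± B g = g 0 + 2 * ∑ B (g ∘ suc)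

sum-range : ∀ B (g : ℕ → ℕ) → sum (map (g ∘ ∣_∣) (range B)) ≡ Σ± B g
sum-range B g = begin
  sum (map (g ∘ ∣_∣) (range B))                   ≡⟨ cong sum (sym (map-∘ (upTo (suc (2 * B))))) ⟩
  sum (map h (upTo (suc (2 * B))))                ≡⟨ sum-applyUpTo h (λ i → i) (suc (2 * B)) ⟩
  ∑ (suc (2 * B)) h                               ≡⟨ cong (λ n → ∑ n h) (1+2B B) ⟩
  ∑ (B + suc B) h                                 ≡⟨ ∑-split B (suc B) h ⟩
  ∑ B h + ∑ (suc B) (λ i → h (B + i))             ≡⟨ cong₂ _+_ (trans (∑-reverse B h) (∑-cong B left))
                                                                (∑-cong (suc B) right) ⟩
  ∑ B (g ∘ suc) + (g 0 + ∑ B (g ∘ suc))           ≡⟨ fold (∑ B (g ∘ suc)) (g 0) ⟩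
  Σ± B g                                          ∎
  where
  open ≡-Reasoning
  h : ℕ → ℕ
  h i = g ∣ + i ℤ.- + B ∣
  ∣i-B∣ : ∀ i → ∣ + i ℤ.- + B ∣ ≡ ∣ ℤ._⊖_ i B ∣
  ∣i-B∣ i = cong ∣_∣ (ℤP.m-n≡m⊖n i B)
  left : ∀ i → i < B → h (B ∸ suc i) ≡ g (suc i)
  left i i<B = cong g (trans (∣i-B∣ (B ∸ suc i)) (trans (ℤP.∣⊖∣-≤ (m∸n≤m B (suc i))) (m∸[m∸n]≡n i<B)))
  right : ∀ i → i < suc B → h (B + i) ≡ g i
  right i _ = cong g (trans (∣i-B∣ (B + i))
    (trans (ℤP.∣m⊖n∣≡∣n⊖m∣ (B + i) B) (trans (ℤP.∣⊖∣-≤ (m≤m+n B i)) (m+n∸m≡n B i))))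
  1+2B : ∀ B → suc (2 * B) ≡ B + suc B
  1+2B = solve-∀
  fold : ∀ s a → s + (a + s) ≡ a + 2 * s
  fold = solve-∀

Σ±-cong : ∀ B {f g : ℕ → ℕ} → (∀ a → a ≤ B → f a ≡ g a) → Σ± B f ≡ Σ± B g
Σ±-cong B eq = cong₂ (λ u v → u + 2 * v) (eq 0 z≤n) (∑-cong B (λ i i<B → eq (suc i) i<B))

Σ±-+ : ∀ B (f g : ℕ → ℕ) → Σ± B (λ a → f a + g a) ≡ Σ± B f + Σ± B g
Σ±-+ B f g = begin
  f 0 + g 0 + 2 * ∑ B (λ i → f (suc i) + g (suc i))
    ≡⟨ cong (λ s → f 0 + g 0 + 2 * s) (∑-+ B (f ∘ suc) (g ∘ suc)) ⟩
  f 0 + g 0 + 2 * (∑ B (f ∘ suc) + ∑ B (g ∘ suc))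
    ≡⟨ cong (_+_ (f 0 + g 0)) (*-distribˡ-+ 2 (∑ B (f ∘ suc)) (∑ B (g ∘ suc))) ⟩
  f 0 + g 0 + (2 * ∑ B (f ∘ suc) + 2 * ∑ B (g ∘ suc))
    ≡⟨ interchange (f 0) (g 0) _ _ ⟩
  Σ± B f + Σ± B g ∎
  where open ≡-Reasoning

Σ±-zero : ∀ B (g : ℕ → ℕ) → (∀ a → a ≤ B → g a ≡ 0) → Σ± B g ≡ 0
Σ±-zero B g eq = trans (Σ±-cong B eq) (cong (2 *_) (trans (∑-const B 0) (*-zeroʳ B)))

Σ±-halve : ∀ B (g : ℕ → ℕ) → (∀ j → g (1 + 2 * j) ≡ 0) → Σ± (2 * B) g ≡ Σ± B (λ a → g (2 * a))
Σ±-halve B g odd = cong (λ s → g 0 + 2 * s) (trans (∑-pairs B (g ∘ suc)) (∑-cong B (λ j _ →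
  cong₂ _+_ (odd j) (cong g (sym (2[1+j] j))))))
  where
  2[1+j] : ∀ j → 2 * suc j ≡ suc (suc (2 * j))
  2[1+j] = solve-∀

Σ±-prefix : ∀ B c (g : ℕ → ℕ) → c ≤ B → (∀ b → b ≤ c → g b ≡ 1) → (∀ b → c < b → b ≤ B → g b ≡ 0) →
            Σ± B g ≡ 1 + 2 * c
Σ±-prefix B c g c≤B ones zeros = cong₂ (λ u v → u + 2 * v) (ones 0 z≤n)
  (∑-prefix B c (g ∘ suc) c≤B (λ i i<c → ones (suc i) i<c) (λ i c≤i i<B → zeros (suc i) (s≤s c≤i) i<B))

-- The number of (x , y) ∈ ℤ² with ∣ x ∣ , ∣ y ∣ ≤ B and P ∣ x ∣ ∣ y ∣.
count : {P : ℕ → ℕ → Set} → ℕ → (∀ a b → Dec (P a b)) → ℕ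
count B P? = Σ± B (λ a → Σ± B (λ b → 𝟙 (P? a b)))

module _ {P Q : ℕ → ℕ → Set} where

  count-split : ∀ B (P? : ∀ a b → Dec (P a b)) (Q? : ∀ a b → Dec (Q a b)) →
                count B (λ a b → P? a b ×-dec ¬? (Q? a b)) + count B (λ a b → P? a b ×-dec Q? a b) ≡ count B P?
  count-split B P? Q? = begin
    Σ± B (λ a → Σ± B (P∧¬Q a)) + Σ± B (λ a → Σ± B (P∧Q a))
      ≡⟨ Σ±-+ B (λ a → Σ± B (P∧¬Q a)) (λ a → Σ± B (P∧Q a)) ⟨
    Σ± B (λ a → Σ± B (P∧¬Q a) + Σ± B (P∧Q a))
      ≡⟨ Σ±-cong B (λ a _ → Σ±-+ B (P∧¬Q a) (P∧Q a)) ⟨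
    Σ± B (λ a → Σ± B (λ b → P∧¬Q a b + P∧Q a b))
      ≡⟨ Σ±-cong B (λ a _ → Σ±-cong B (λ b _ → 𝟙-split (P? a b) (Q? a b))) ⟩
    count B P? ∎
    where
    open ≡-Reasoning
    P∧¬Q P∧Q : ℕ → ℕ → ℕ
    P∧¬Q a b = 𝟙 (P? a b ×-dec ¬? (Q? a b))
    P∧Q  a b = 𝟙 (P? a b ×-dec Q? a b)

Region : ℕ → ℕ → ℕ → ℕ → Set
Region B D a b = a ≤ B × b ≤ B × a + b ≤ D

region? : ∀ B D a b → Dec (Region B D a b)
region? B D a b = a ≤? B ×-dec b ≤? B ×-dec a + b ≤? D

BothEven : ℕ → ℕ → Set
BothEven a b = (2 ∣ a) × (2 ∣ b)

bothEven? : ∀ a b → Dec (BothEven a b)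
bothEven? a b = 2 ∣? a ×-dec 2 ∣? b

evenPoint? : ∀ B D a b → Dec (Region B D a b × BothEven a b)
evenPoint? B D a b = region? B D a b ×-dec bothEven? a b

oddPoint? : ∀ B D a b → Dec (Region B D a b × ¬ BothEven a b)
oddPoint? B D a b = region? B D a b ×-dec ¬? (bothEven? a b)

regionSize : ℕ → ℕ → ℕ
regionSize e t = (1 + 2 * e) * (1 + 2 * (e + t)) + 2 * (t * (t + 2 * e))

count-region : ∀ e t → count (e + t) (region? (e + t) (e + (e + t))) ≡ regionSize e t
count-region e t = begin
  row 0 + 2 * ∑ (e + t) (row ∘ suc)
    ≡⟨ cong (λ s → row 0 + 2 * s) (∑-split e t (row ∘ suc)) ⟩
  row 0 + 2 * (∑ e (row ∘ suc) + ∑ t (λ i → row (suc (e + i))))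
    ≡⟨ cong₂ (λ u v → u + 2 * v) (full-row 0 z≤n) (cong₂ _+_ full-rows partial-rows) ⟩
  (1 + 2 * B) + 2 * (e * (1 + 2 * B) + t * (t + 2 * e))
    ≡⟨ collect e t ⟩
  regionSize e t ∎
  where
  open ≡-Reasoning
  B D : ℕ
  B = e + t
  D = e + B
  row : ℕ → ℕ
  row a = Σ± B (λ b → 𝟙 (region? B D a b))
  row-length : ∀ a c → a ≤ B → c ≤ B → a + c ≤ D → (∀ b → c < b → b ≤ B → D < a + b) → row a ≡ 1 + 2 * c
  row-length a c a≤B c≤B a+c≤D beyond = Σ±-prefix B c _ c≤B
    (λ b b≤c → 𝟙-yes (region? B D a b) (a≤B , ≤-trans b≤c c≤B , ≤-trans (+-monoʳ-≤ a b≤c) a+c≤D))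
    (λ b c<b b≤B → 𝟙-no (region? B D a b) (<⇒≱ (beyond b c<b b≤B) ∘ proj₂ ∘ proj₂))
  full-row : ∀ a → a ≤ e → row a ≡ 1 + 2 * B
  full-row a a≤e = row-length a B (≤-trans a≤e (m≤m+n e t)) ≤-refl (+-monoˡ-≤ B a≤e)
    (λ b B<b b≤B → contradiction b≤B (<⇒≱ B<b))
  full-rows : ∑ e (row ∘ suc) ≡ e * (1 + 2 * B)
  full-rows = trans (∑-cong e (λ i i<e → full-row (suc i) i<e)) (∑-const e _)
  partial-row : ∀ i → i < t → row (suc (e + i)) ≡ 1 + 2 * (e + (t ∸ suc i))
  partial-row i i<t = row-length a c a≤B (+-monoʳ-≤ e (m∸n≤m t (suc i))) (≤-reflexive a+c≡D)
    (λ b c<b _ → subst (_< a + b) a+c≡D (+-monoʳ-< a c<b))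
    where
    a c : ℕ
    a = suc (e + i)
    c = e + (t ∸ suc i)
    a≤B : a ≤ B
    a≤B = subst (_≤ B) (+-suc e i) (+-monoʳ-≤ e i<t)
    regroup : ∀ e i s → suc (e + i) + (e + s) ≡ e + (e + (suc i + s))
    regroup = solve-∀
    a+c≡D : a + c ≡ D
    a+c≡D = trans (regroup e i (t ∸ suc i)) (cong (λ s → e + (e + s)) (m+[n∸m]≡n i<t))
  partial-rows : ∑ t (λ i → row (suc (e + i))) ≡ t * (t + 2 * e)
  partial-rows = trans (∑-cong t partial-row) (∑-descending-odd t e)
  collect : ∀ e t → (1 + 2 * (e + t)) + 2 * (e * (1 + 2 * (e + t)) + t * (t + 2 * e)) ≡
                    (1 + 2 * e) * (1 + 2 * (e + t)) + 2 * (t * (t + 2 * e))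
  collect = solve-∀

2∤1+2*j : ∀ j → ¬ 2 ∣ 1 + 2 * j
2∤1+2*j j (divides q eq) = even≢odd q j (sym (trans eq (*-comm q 2)))

2x≤1+2D⇒x≤D : ∀ {x D} → 2 * x ≤ 1 + 2 * D → x ≤ D
2x≤1+2D⇒x≤D {x} {D} 2x≤1+2D with x ≤? D
... | yes x≤D = x≤D
... | no  x≰D = contradiction 2x≤1+2D (<⇒≱ (begin-strict
  1 + 2 * D <⟨ n<1+n _ ⟩
  2 + 2 * D ≡⟨ *-distribˡ-+ 2 1 D ⟨
  2 * suc D ≤⟨ *-monoʳ-≤ 2 (≰⇒> x≰D) ⟩
  2 * x     ∎))
  where open ≤-Reasoning

count-evenRegion : ∀ B D → count (2 * B) (evenPoint? (2 * B) (1 + 2 * D)) ≡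
                           count B (region? B D)
count-evenRegion B D = begin
  Σ± (2 * B) (λ a → Σ± (2 * B) (E a))
    ≡⟨ Σ±-cong (2 * B) (λ a _ → Σ±-halve B (E a) (λ j → 𝟙-no (E? a (1 + 2 * j)) (2∤1+2*j j ∘ proj₂ ∘ proj₂))) ⟩
  Σ± (2 * B) (λ a → Σ± B (λ b → E a (2 * b)))
    ≡⟨ Σ±-halve B (λ a → Σ± B (λ b → E a (2 * b))) (λ j →
         Σ±-zero B _ (λ b _ → 𝟙-no (E? (1 + 2 * j) (2 * b)) (2∤1+2*j j ∘ proj₁ ∘ proj₂))) ⟩
  Σ± B (λ a → Σ± B (λ b → E (2 * a) (2 * b)))
    ≡⟨ Σ±-cong B (λ a _ → Σ±-cong B (λ b _ → 𝟙-cong (E? (2 * a) (2 * b)) (region? B D a b) halve double)) ⟩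
  count B (region? B D) ∎
  where
  open ≡-Reasoning
  E? : ∀ a b → Dec (Region (2 * B) (1 + 2 * D) a b × BothEven a b)
  E? = evenPoint? (2 * B) (1 + 2 * D)
  E : ℕ → ℕ → ℕ
  E a b = 𝟙 (E? a b)
  halve : ∀ {a b} → Region (2 * B) (1 + 2 * D) (2 * a) (2 * b) × BothEven (2 * a) (2 * b) → Region B D a b
  halve {a} {b} ((2a≤2B , 2b≤2B , 2a+2b≤1+2D) , _) =
    *-cancelˡ-≤ 2 2a≤2B , *-cancelˡ-≤ 2 2b≤2B , 2x≤1+2D⇒x≤D (subst (_≤ 1 + 2 * D) (sym (*-distribˡ-+ 2 a b)) 2a+2b≤1+2D)
  double : ∀ {a b} → Region B D a b → Region (2 * B) (1 + 2 * D) (2 * a) (2 * b) × BothEven (2 * a) (2 * b)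
  double {a} {b} (a≤B , b≤B , a+b≤D) =
    (*-monoʳ-≤ 2 a≤B , *-monoʳ-≤ 2 b≤B , subst (_≤ 1 + 2 * D) (*-distribˡ-+ 2 a b) (m≤n⇒m≤1+n (*-monoʳ-≤ 2 a+b≤D))) ,
    m∣m*n a , m∣m*n b

count-oddRegion : ∀ e t e′ t′ → e + t ≡ 2 * (e′ + t′) → e + (e + t) ≡ 1 + 2 * (e′ + (e′ + t′)) →
                  count (e + t) (oddPoint? (e + t) (e + (e + t))) + regionSize e′ t′ ≡
                  regionSize e t
count-oddRegion e t e′ t′ B≡2B′ D≡1+2D′ = begin
  count B (oddPoint? B D) + regionSize e′ t′
    ≡⟨ cong (_+_ (count B (oddPoint? B D))) evens ⟩
  count B (oddPoint? B D) + count B (evenPoint? B D)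
    ≡⟨ count-split B (region? B D) bothEven? ⟩
  count B (region? B D)
    ≡⟨ count-region e t ⟩
  regionSize e t ∎
  where
  open ≡-Reasoning
  B D : ℕ
  B = e + t
  D = e + B
  evens : regionSize e′ t′ ≡ count B (evenPoint? B D)
  evens = sym (subst₂ (λ B D → count B (evenPoint? B D) ≡ regionSize e′ t′)
    (sym B≡2B′) (sym D≡1+2D′) (trans (count-evenRegion (e′ + t′) (e′ + (e′ + t′))) (count-region e′ t′)))

-- gcd x y is odd exactly when x and y are not both even, and this also excludes (0 , 0).
𝟙-InS : ∀ n x y → 𝟙 (InS? n (x , y)) ≡ 𝟙 (oddPoint? (w n ∸ 2) (w (suc n) ∸ 3) ∣ x ∣ ∣ y ∣)
𝟙-InS n x y = 𝟙-cong (InS? n (x , y)) (oddPoint? (w n ∸ 2) (w (suc n) ∸ 3) ∣ x ∣ ∣ y ∣) to from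
  where
  to : InS n (x , y) → Region (w n ∸ 2) (w (suc n) ∸ 3) (∣ x ∣) (∣ y ∣) × ¬ BothEven (∣ x ∣) (∣ y ∣)
  to (_ , ∣x∣≤B , ∣y∣≤B , ∣x∣+∣y∣≤D , odd) =
    (ℤP.drop‿+≤+ ∣x∣≤B , ℤP.drop‿+≤+ ∣y∣≤B , ℤP.drop‿+≤+ ∣x∣+∣y∣≤D) , λ (2∣x , 2∣y) → odd (ℕG.gcd-greatest 2∣x 2∣y)
  from : Region (w n ∸ 2) (w (suc n) ∸ 3) (∣ x ∣) (∣ y ∣) × ¬ BothEven (∣ x ∣) (∣ y ∣) → InS n (x , y)
  from ((∣x∣≤B , ∣y∣≤B , ∣x∣+∣y∣≤D) , notBothEven) =
    nonzero , ℤ.+≤+ ∣x∣≤B , ℤ.+≤+ ∣y∣≤B , ℤ.+≤+ ∣x∣+∣y∣≤D ,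
    λ 2∣gcd → notBothEven (∣-trans 2∣gcd (ℕG.gcd[m,n]∣m ∣ x ∣ ∣ y ∣) , ∣-trans 2∣gcd (ℕG.gcd[m,n]∣n ∣ x ∣ ∣ y ∣))
    where
    nonzero : ¬ (x , y) ≡ (+ 0 , + 0)
    nonzero refl = notBothEven (divides 0 refl , divides 0 refl)

cardS≡count : ∀ n → cardS n ≡ count (w n ∸ 2) (oddPoint? (w n ∸ 2) (w (suc n) ∸ 3))
cardS≡count n = begin
  length (filter (InS? n) (box B))
    ≡⟨ length-filter≡sum-𝟙 (InS? n) (box B) ⟩
  sum (map (𝟙 ∘ InS? n) (box B))
    ≡⟨ sum-concatMap (λ x → map (x ,_) (range B)) (𝟙 ∘ InS? n) (range B) ⟩
  sum (map (λ x → sum (map (𝟙 ∘ InS? n) (map (x ,_) (range B)))) (range B))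
    ≡⟨ cong sum (map-cong column (range B)) ⟩
  sum (map (λ x → Σ± B (λ b → 𝟙 (O? ∣ x ∣ b))) (range B))
    ≡⟨ sum-range B (λ a → Σ± B (λ b → 𝟙 (O? a b))) ⟩
  count B O? ∎
  where
  open ≡-Reasoning
  B : ℕ
  B = w n ∸ 2
  O? : ∀ a b → Dec (Region B (w (suc n) ∸ 3) a b × ¬ BothEven a b)
  O? = oddPoint? B (w (suc n) ∸ 3)
  column : ∀ x → sum (map (𝟙 ∘ InS? n) (map (x ,_) (range B))) ≡ Σ± B (λ b → 𝟙 (O? ∣ x ∣ b))
  column x = begin
    sum (map (𝟙 ∘ InS? n) (map (x ,_) (range B))) ≡⟨ cong sum (map-∘ (range B)) ⟨
    sum (map (𝟙 ∘ InS? n ∘ (x ,_)) (range B))      ≡⟨ cong sum (map-cong (𝟙-InS n x) (range B)) ⟩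
    sum (map (λ y → 𝟙 (O? ∣ x ∣ ∣ y ∣)) (range B)) ≡⟨ sum-range B (λ b → 𝟙 (O? ∣ x ∣ b)) ⟩
    Σ± B (λ b → 𝟙 (O? ∣ x ∣ b))                   ∎

cardS-closedForm : ∀ {n a b P} e t e′ t′ → w n ≡ 2 + (e + t) → w (suc n) ≡ 3 + (e + (e + t)) →
                   e + t ≡ 2 * (e′ + t′) → e + (e + t) ≡ 1 + 2 * (e′ + (e′ + t′)) →
                   regionSize e t + a * P ≡ b * (P * P) + 8 + regionSize e′ t′ →
                   cardS n + a * P ≡ b * (P * P) + 8
cardS-closedForm {n} {a} {b} {P} e t e′ t′ w[n] w[1+n] B≡2B′ D≡1+2D′ closed =
  +-cancelʳ-≡ (regionSize e′ t′) _ _ (begin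
    cardS n + a * P + regionSize e′ t′
      ≡⟨ xy∙z≈xz∙y (cardS n) _ _ ⟩
    cardS n + regionSize e′ t′ + a * P
      ≡⟨ cong (λ c → c + regionSize e′ t′ + a * P) (trans (cardS≡count n) bounds) ⟩
    count (e + t) (oddPoint? (e + t) (e + (e + t))) + regionSize e′ t′ + a * P
      ≡⟨ cong (_+ a * P) (count-oddRegion e t e′ t′ B≡2B′ D≡1+2D′) ⟩
    regionSize e t + a * P
      ≡⟨ closed ⟩
    b * (P * P) + 8 + regionSize e′ t′ ∎)
  where
  open ≡-Reasoning
  bounds : count (w n ∸ 2) (oddPoint? (w n ∸ 2) (w (suc n) ∸ 3)) ≡ count (e + t) (oddPoint? (e + t) (e + (e + t)))
  bounds = cong₂ (λ B D → count B (oddPoint? B D))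
    (trans (cong (_∸ 2) w[n]) (m+n∸m≡n 2 _)) (trans (cong (_∸ 3) w[1+n]) (m+n∸m≡n 3 _))

w-even : ∀ k → w (2 * k) ≡ 3 * 2 ^ k
w-even k = cong₂ (λ r q → (3 + r) * 2 ^ q)
  (trans (%-congˡ (*-comm 2 k)) (m*n%n≡0 k 2)) (trans (/-congˡ (*-comm 2 k)) (m*n/n≡m k 2))

w-odd : ∀ k → w (2 * k + 1) ≡ 4 * 2 ^ k
w-odd k = cong₂ (λ r q → (3 + r) * 2 ^ q) (%-remove-+ˡ 1 (m∣m*n k))
  (trans (+-distrib-/-∣ˡ 1 (m∣m*n k)) (trans (+-identityʳ _) (trans (/-congˡ (*-comm 2 k)) (m*n/n≡m k 2))))

-- With 2 ^ k = 1 + p the region of S_(2k+1) has e = t = 1 + 2 p, and its even part has e′ = p, t′ = 1 + p.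
cardS-odd : ∀ k → cardS (2 * k + 1) + 34 * 2 ^ k ≡ 42 * (2 ^ k * 2 ^ k) + 8
cardS-odd k with m≤n⇒∃[o]m+o≡n (m^n>0 2 k)
... | p , 1+p≡2^k rewrite sym 1+p≡2^k =
  cardS-closedForm {2 * k + 1} {34} {42} {suc p} e e p (suc p) w[n] w[1+n] (B≡2B′ p) (D≡1+2D′ p) (closed p)
  where
  e : ℕ
  e = 1 + 2 * p
  2[k+1] : ∀ k → suc (2 * k + 1) ≡ 2 * suc k
  2[k+1] = solve-∀
  4[1+p] : ∀ p → 4 * suc p ≡ 2 + ((1 + 2 * p) + (1 + 2 * p))
  4[1+p] = solve-∀
  6[1+p] : ∀ p → 3 * (2 * suc p) ≡ 3 + ((1 + 2 * p) + ((1 + 2 * p) + (1 + 2 * p)))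
  6[1+p] = solve-∀
  w[n] : w (2 * k + 1) ≡ 2 + (e + e)
  w[n] = trans (w-odd k) (trans (cong (4 *_) (sym 1+p≡2^k)) (4[1+p] p))
  w[1+n] : w (suc (2 * k + 1)) ≡ 3 + (e + (e + e))
  w[1+n] = trans (cong w (2[k+1] k)) (trans (w-even (suc k)) (trans (cong (λ P → 3 * (2 * P)) (sym 1+p≡2^k)) (6[1+p] p)))
  B≡2B′ : ∀ p → (1 + 2 * p) + (1 + 2 * p) ≡ 2 * (p + suc p)
  B≡2B′ = solve-∀
  D≡1+2D′ : ∀ p → (1 + 2 * p) + ((1 + 2 * p) + (1 + 2 * p)) ≡ 1 + 2 * (p + (p + suc p))
  D≡1+2D′ = solve-∀
  closed : ∀ p → (1 + 2 * (1 + 2 * p)) * (1 + 2 * ((1 + 2 * p) + (1 + 2 * p)))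
                   + 2 * ((1 + 2 * p) * ((1 + 2 * p) + 2 * (1 + 2 * p))) + 34 * suc p ≡
                 42 * (suc p * suc p) + 8
                   + ((1 + 2 * p) * (1 + 2 * (p + suc p)) + 2 * (suc p * (suc p + 2 * p)))
  closed = solve-∀

-- With 2 ^ k = 1 + q the region of S_(2k+2) has e = 1 + 2 q, t = 3 + 4 q, and its even part has e′ = q, t′ = 2 + 2 q.
cardS-even : ∀ k → cardS (2 * suc k) + 24 * 2 ^ suc k ≡ 21 * (2 ^ suc k * 2 ^ suc k) + 8
cardS-even k with m≤n⇒∃[o]m+o≡n (m^n>0 2 k)
... | q , 1+q≡2^k rewrite sym 1+q≡2^k =
  cardS-closedForm {2 * suc k} {24} {21} {2 * suc q} e t q (2 + 2 * q) w[n] w[1+n] (B≡2B′ q) (D≡1+2D′ q) (closed q)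
  where
  e t : ℕ
  e = 1 + 2 * q
  t = 3 + 4 * q
  2[k+1]+1 : ∀ k → suc (2 * suc k) ≡ 2 * suc k + 1
  2[k+1]+1 = solve-∀
  6[1+q] : ∀ q → 3 * (2 * suc q) ≡ 2 + ((1 + 2 * q) + (3 + 4 * q))
  6[1+q] = solve-∀
  8[1+q] : ∀ q → 4 * (2 * suc q) ≡ 3 + ((1 + 2 * q) + ((1 + 2 * q) + (3 + 4 * q)))
  8[1+q] = solve-∀
  w[n] : w (2 * suc k) ≡ 2 + (e + t)
  w[n] = trans (w-even (suc k)) (trans (cong (λ P → 3 * (2 * P)) (sym 1+q≡2^k)) (6[1+q] q))
  w[1+n] : w (suc (2 * suc k)) ≡ 3 + (e + (e + t))
  w[1+n] = trans (cong w (2[k+1]+1 k)) (trans (w-odd (suc k)) (trans (cong (λ P → 4 * (2 * P)) (sym 1+q≡2^k)) (8[1+q] q)))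
  B≡2B′ : ∀ q → (1 + 2 * q) + (3 + 4 * q) ≡ 2 * (q + (2 + 2 * q))
  B≡2B′ = solve-∀
  D≡1+2D′ : ∀ q → (1 + 2 * q) + ((1 + 2 * q) + (3 + 4 * q)) ≡ 1 + 2 * (q + (q + (2 + 2 * q)))
  D≡1+2D′ = solve-∀
  closed : ∀ q → (1 + 2 * (1 + 2 * q)) * (1 + 2 * ((1 + 2 * q) + (3 + 4 * q)))
                   + 2 * ((3 + 4 * q) * ((3 + 4 * q) + 2 * (1 + 2 * q))) + 24 * (2 * suc q) ≡
                 21 * (2 * suc q * (2 * suc q)) + 8
                   + ((1 + 2 * q) * (1 + 2 * (q + (2 + 2 * q))) + 2 * ((2 + 2 * q) * ((2 + 2 * q) + 2 * q)))
  closed = solve-∀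

pos-^ : ∀ m k → (+ m) ℤ.^ k ≡ + (m ^ k)
pos-^ m zero    = refl
pos-^ m (suc k) = trans (cong (+ m ℤ.*_) (pos-^ m k)) (sym (ℤP.pos-* m (m ^ k)))

4^n≡2^n*2^n : ∀ n → 4 ^ n ≡ 2 ^ n * 2 ^ n
4^n≡2^n*2^n zero    = refl
4^n≡2^n*2^n (suc n) = trans (cong (4 *_) (4^n≡2^n*2^n n)) (regroup (2 ^ n))
  where
  regroup : ∀ x → 4 * (x * x) ≡ 2 * x * (2 * x)
  regroup = solve-∀

toℤ-closedForm : ∀ {c} a b k → c + a * 2 ^ k ≡ b * (2 ^ k * 2 ^ k) + 8 →
                 + c ≡ + b ℤ.* (+ 4) ℤ.^ k ℤ.- + a ℤ.* (+ 2) ℤ.^ k ℤ.+ + 8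
toℤ-closedForm {c} a b k eq = begin
  + c                                     ≡⟨ add-sub (+ c) (+ a ℤ.* X) ⟩
  + c ℤ.+ + a ℤ.* X ℤ.- + a ℤ.* X         ≡⟨ cong (ℤ._- + a ℤ.* X) lifted ⟩
  + b ℤ.* (X ℤ.* X) ℤ.+ + 8 ℤ.- + a ℤ.* X ≡⟨ reorder (+ b) X (+ a) ⟩
  + b ℤ.* (X ℤ.* X) ℤ.- + a ℤ.* X ℤ.+ + 8 ≡⟨ cong₂ (λ Y Z → + b ℤ.* Y ℤ.- + a ℤ.* Z ℤ.+ + 8) 4^k 2^k ⟩
  + b ℤ.* (+ 4) ℤ.^ k ℤ.- + a ℤ.* (+ 2) ℤ.^ k ℤ.+ + 8 ∎
  where
  open ≡-Reasoning
  X : ℤ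
  X = + (2 ^ k)
  2^k : X ≡ (+ 2) ℤ.^ k
  2^k = sym (pos-^ 2 k)
  4^k : X ℤ.* X ≡ (+ 4) ℤ.^ k
  4^k = trans (sym (ℤP.pos-* (2 ^ k) (2 ^ k))) (trans (cong +_ (sym (4^n≡2^n*2^n k))) (sym (pos-^ 4 k)))
  lifted : + c ℤ.+ + a ℤ.* X ≡ + b ℤ.* (X ℤ.* X) ℤ.+ + 8
  lifted = begin
    + c ℤ.+ + a ℤ.* X              ≡⟨ cong (ℤ._+_ (+ c)) (ℤP.pos-* a (2 ^ k)) ⟨
    + c ℤ.+ + (a * 2 ^ k)          ≡⟨ ℤP.pos-+ c (a * 2 ^ k) ⟨
    + (c + a * 2 ^ k)              ≡⟨ cong +_ eq ⟩
    + (b * (2 ^ k * 2 ^ k) + 8)    ≡⟨ ℤP.pos-+ (b * (2 ^ k * 2 ^ k)) 8 ⟩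
    + (b * (2 ^ k * 2 ^ k)) ℤ.+ + 8 ≡⟨ cong (ℤ._+ + 8) (trans (ℤP.pos-* b _) (cong (+ b ℤ.*_) (ℤP.pos-* (2 ^ k) _))) ⟩
    + b ℤ.* (X ℤ.* X) ℤ.+ + 8      ∎
  add-sub : ∀ x y → x ≡ x ℤ.+ y ℤ.- y
  add-sub = ℤ-solve-∀
  reorder : ∀ u v z → u ℤ.* (v ℤ.* v) ℤ.+ + 8 ℤ.- z ℤ.* v ≡ u ℤ.* (v ℤ.* v) ℤ.- z ℤ.* v ℤ.+ + 8
  reorder = ℤ-solve-∀

corollary4p2 : ((k : ℕ) → + cardS (2 * k + 1) ≡ + 42 ℤ.* (+ 4) ℤ.^ k ℤ.- + 34 ℤ.* (+ 2) ℤ.^ k ℤ.+ + 8)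
    × ((k : ℕ) → + cardS (2 * suc k) ≡ + 21 ℤ.* (+ 4) ℤ.^ suc k ℤ.- + 24 ℤ.* (+ 2) ℤ.^ suc k ℤ.+ + 8)
corollary4p2 = (λ k → toℤ-closedForm 34 42 k (cardS-odd k)) , (λ k → toℤ-closedForm 24 21 (suc k) (cardS-even k))
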